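{- Let $G$ be a finite simple graph that contains no 4-cycle (as a subgraph, induced or not), with order $n$, minimum degree $\delta$ and equator $q>15$. Then \[ n\ \ge\ \frac{q}{5}\left(\delta^2-2\left\lfloor\frac{\delta}{2}\right\rfloor+1\right). \]
   Context: A cycle $C$ in $G$ is isometric if $d_C(x,y)=d_G(x,y)$ for all vertices $x,y$ of $C$. The equator of $G$ is the length of a longest isometric cycle of $G$. -}

module Defs where

open import Data.Nat using (ℕ; zero; suc; _+_; _*_; _∸_; _≤_; _<_; _⊓_; ∣_-_∣)
open import Data.Fin using (Fin; toℕ)
open import Data.Bool using (Bool; true; false; T; if_then_else_)
open import Data.List using (List; map)
open import Data.Nat.ListAction using (sum)
open import Data.List.Base using (allFin)
open import Data.Product using (Σ; _×_; ∃)
open import Data.Sum using (_⊎_)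
open import Relation.Binary.PropositionalEquality using (_≡_; _≢_)
open import Relation.Nullary using (¬_)
open import Function.Definitions using (Injective)

record Graph (n : ℕ) : Set where
  field
    adj    : Fin n → Fin n → Bool
    sym    : ∀ x y → adj x y ≡ adj y x
    irrefl : ∀ x → adj x x ≡ false

module _ {n : ℕ} (G : Graph n) where
  open Graph G

  Edge : Fin n → Fin n → Set
  Edge x y = T (adj x y)

  degree : Fin n → ℕ
  degree v = sum (map (λ w → if adj v w then 1 else 0) (allFin n))

  MinDegree : ℕ → Set
  MinDegree δ = (∀ v → δ ≤ degree v) × (∃ λ v → degree v ≡ δ)

  data Walk : Fin n → Fin n → ℕ → Set where
    here : ∀ x → Walk x x 0
    step : ∀ {x y z ℓ} → Edge x y → Walk y z ℓ → Walk x z (suc ℓ)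

  Dist : Fin n → Fin n → ℕ → Set
  Dist x y d = Walk x y d × (∀ m → m < d → ¬ Walk x y m)

  C4Free : Set
  C4Free = ∀ a b c d → a ≢ b → a ≢ c → a ≢ d → b ≢ c → b ≢ d → c ≢ d →
           ¬ (Edge a b × Edge b c × Edge c d × Edge d a)

  record Cycle (k : ℕ) : Set where
    field
      len≥3  : 3 ≤ k
      vertex : Fin k → Fin n
      inj    : Injective _≡_ _≡_ vertex
      edges  : ∀ i j → (suc (toℕ i) ≡ toℕ j ⊎ (toℕ i ≡ k ∸ 1 × toℕ j ≡ 0)) →
               Edge (vertex i) (vertex j)

  cycDist : (k : ℕ) → Fin k → Fin k → ℕ
  cycDist k i j = ∣ toℕ i - toℕ j ∣ ⊓ (k ∸ ∣ toℕ i - toℕ j ∣)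

  IsIsometric : {k : ℕ} → Cycle k → Set
  IsIsometric {k} C = ∀ i j → Dist (vertex i) (vertex j) (cycDist k i j)
    where open Cycle C

  IsometricCycle : ℕ → Set
  IsometricCycle k = Σ (Cycle k) IsIsometric

  Equator : ℕ → Set
  Equator q = IsometricCycle q × (∀ k → IsometricCycle k → k ≤ q)

{-# OPTIONS --safe #-}
module Submission where

-- In a C4-free graph two distinct vertices have at most one common neighbour.  Of the at least
-- dδ walks v – u – w from a vertex v of degree d ≥ δ, exactly d return to v, and those ending in
-- N(v) are at most d and even in number (each edge inside N(v) is traversed both ways); every
-- vertex outside N[v] is the end of at most one of them.  Hence the ball of radius 2 around v
-- has at least δ² − 2⌊δ/2⌋ + 1 vertices.  On an isometric cycle of length q > 12, the cycle
-- vertices whose balls contain a fixed vertex are pairwise at distance ≤ 4 in G, hence along the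
-- cycle, so there are at most five of them.  Double counting the incidences gives the bound.

open import Defs
open import Data.Nat using (ℕ; _+_; _*_; _∸_; _/_; _≤_; _<_)
open import Data.Nat using (zero; suc; z≤n; s≤s; _%_; _≤?_; _<ᵇ_; _⊓_; ∣_-_∣)
open import Data.Nat.Properties
open import Data.Nat.DivMod using (m≡m%n+[m/n]*n; m%n<n; m≥n⇒m/n>0)
open import Data.Nat.Divisibility using (_∣_; divides; ∣m∣n⇒∣m+n)
open import Data.Nat.Tactic.RingSolver using (solve-∀)
import Data.Nat.ListAction as ListAction
open import Algebra.Properties.Semiring.Sum +-*-semiring
  using (sum; sum-syntax; sum-cong-≗; sum-replicate-zero; ∑-distrib-+; ∑-comm;
         *-distribˡ-sum; *-distribʳ-sum)
open import Data.Fin as Fin using (Fin; toℕ)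
import Data.Fin.Properties as Finₚ
open import Data.Bool using (Bool; true; false; T; if_then_else_; _∧_; _∨_; not)
open import Data.Bool.Properties using (T-∧; ∧-idem)
import Data.List as List
open import Data.List.Properties using (map-tabulate)
open import Data.Product using (_×_; _,_; ∃-syntax; ∃₂)
open import Data.Sum using (_⊎_; inj₁; inj₂)
open import Data.Unit using (tt)
open import Data.Empty using (⊥; ⊥-elim)
open import Function using (_∘_; id; Equivalence)
open import Relation.Binary.PropositionalEquality
open import Relation.Nullary using (¬_; yes; no; does)

𝟙 : Bool → ℕ
𝟙 b = if b then 1 else 0

𝟙-∧ : ∀ a b → 𝟙 (a ∧ b) ≡ 𝟙 a * 𝟙 b
𝟙-∧ true  true  = refl
𝟙-∧ true  false = refl
𝟙-∧ false _     = refl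

_==_ : ∀ {m} → Fin m → Fin m → Bool
i == j = does (i Finₚ.≟ j)

count : ∀ {m} → (Fin m → Bool) → ℕ
count {m} p = ∑[ i < m ] 𝟙 (p i)

∑-mono-≤ : ∀ {m} {f g : Fin m → ℕ} → (∀ i → f i ≤ g i) → sum f ≤ sum g
∑-mono-≤ {zero}  f≤g = z≤n
∑-mono-≤ {suc m} f≤g = +-mono-≤ (f≤g Fin.zero) (∑-mono-≤ (f≤g ∘ Fin.suc))

∑-const : ∀ m c → ∑[ i < m ] c ≡ m * c
∑-const zero    c = refl
∑-const (suc m) c = cong (c +_) (∑-const m c)

∑-distrib-+₃ : ∀ {m} (f g h : Fin m → ℕ) →
               ∑[ i < m ] (f i + g i + h i) ≡ sum f + sum g + sum h
∑-distrib-+₃ f g h = trans (∑-distrib-+ _ h) (cong (_+ sum h) (∑-distrib-+ f g))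

∑-split₃ : ∀ {m} (a b c f : Fin m → ℕ) → (∀ i → a i + b i + c i ≡ 1) →
           sum f ≡ ∑[ i < m ] (a i * f i) + ∑[ i < m ] (b i * f i) + ∑[ i < m ] (c i * f i)
∑-split₃ {m} a b c f partition = trans (sum-cong-≗ {m} split) (∑-distrib-+₃ {m} _ _ _)
  where
  distribʳ : ∀ a b c x → (a + b + c) * x ≡ a * x + b * x + c * x
  distribʳ = solve-∀
  split : ∀ i → f i ≡ a i * f i + b i * f i + c i * f i
  split i = begin
    f i                        ≡⟨ *-identityˡ (f i) ⟨
    1 * f i                    ≡⟨ cong (_* f i) (partition i) ⟨
    (a i + b i + c i) * f i    ≡⟨ distribʳ (a i) (b i) (c i) (f i) ⟩
    a i * f i + b i * f i + c i * f i ∎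
    where open ≡-Reasoning

∑-pick : ∀ {m} (v : Fin m) (f : Fin m → ℕ) → ∑[ w < m ] (𝟙 (v == w) * f w) ≡ f v
∑-pick {suc m} Fin.zero f =
  trans (cong₂ _+_ (*-identityˡ (f Fin.zero)) (sum-replicate-zero m)) (+-identityʳ _)
∑-pick (Fin.suc v) f = ∑-pick v (f ∘ Fin.suc)

count-≟ : ∀ {m} (v : Fin m) → count (v ==_) ≡ 1
count-≟ {m} v = trans (sum-cong-≗ {m} (λ w → sym (*-identityʳ _))) (∑-pick v (λ _ → 1))

sum-tabulate : ∀ {m} (f : Fin m → ℕ) → ListAction.sum (List.tabulate f) ≡ sum f
sum-tabulate {zero}  f = refl
sum-tabulate {suc m} f = cong (f Fin.zero +_) (sum-tabulate (f ∘ Fin.suc))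

double-count : ∀ {m n a b} (h : Fin m → Fin n → ℕ) →
               (∀ i → a ≤ ∑[ j < n ] h i j) → (∀ j → ∑[ i < m ] h i j ≤ b) →
               m * a ≤ n * b
double-count {m} {n} {a} {b} h rows columns = begin
  m * a                        ≡⟨ ∑-const m a ⟨
  ∑[ i < m ] a                 ≤⟨ ∑-mono-≤ rows ⟩
  ∑[ i < m ] ∑[ j < n ] h i j  ≡⟨ ∑-comm h ⟩
  ∑[ j < n ] ∑[ i < m ] h i j  ≤⟨ ∑-mono-≤ columns ⟩
  ∑[ j < n ] b                 ≡⟨ ∑-const n b ⟩
  n * b                        ∎
  where open ≤-Reasoning

∑∑-symmetric-even : ∀ {m} (h : Fin m → Fin m → ℕ) →
                    (∀ i j → h i j ≡ h j i) → (∀ i → h i i ≡ 0) →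
                    2 ∣ ∑[ i < m ] ∑[ j < m ] h i j
∑∑-symmetric-even {zero}  h h-sym h-diag = divides 0 refl
∑∑-symmetric-even {suc m} h h-sym h-diag =
  subst (2 ∣_) (sym split) (∣m∣n⇒∣m+n (divides R (r+r≡r*2 R)) rest-even)
  where
  R rest : ℕ
  R    = ∑[ j < m ] h Fin.zero (Fin.suc j)
  rest = ∑[ i < m ] ∑[ j < m ] h (Fin.suc i) (Fin.suc j)
  rest-even : 2 ∣ rest
  rest-even = ∑∑-symmetric-even (λ i j → h (Fin.suc i) (Fin.suc j))
                (λ i j → h-sym (Fin.suc i) (Fin.suc j)) (h-diag ∘ Fin.suc)
  r+r≡r*2 : ∀ r → r + r ≡ r * 2
  r+r≡r*2 = solve-∀
  open ≡-Reasoning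
  split : ∑[ i < suc m ] ∑[ j < suc m ] h i j ≡ R + R + rest
  split = begin
    h Fin.zero Fin.zero + R + ∑[ i < m ] (h (Fin.suc i) Fin.zero + ∑[ j < m ] h (Fin.suc i) (Fin.suc j))
      ≡⟨ cong₂ (λ x y → x + R + y) (h-diag Fin.zero) (∑-distrib-+ {m} _ _) ⟩
    R + (∑[ i < m ] h (Fin.suc i) Fin.zero + rest)
      ≡⟨ cong (λ x → R + (x + rest)) (sum-cong-≗ (λ i → h-sym (Fin.suc i) Fin.zero)) ⟩
    R + (R + rest)
      ≡⟨ +-assoc R R rest ⟨
    R + R + rest ∎

δ≤1+[δ/2]*2 : ∀ δ → δ ≤ suc (δ / 2 * 2)
δ≤1+[δ/2]*2 δ = begin
  δ                  ≡⟨ m≡m%n+[m/n]*n δ 2 ⟩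
  δ % 2 + δ / 2 * 2  ≤⟨ +-monoˡ-≤ (δ / 2 * 2) (≤-pred (m%n<n δ 2)) ⟩
  suc (δ / 2 * 2)    ∎
  where open ≤-Reasoning

δ*δ≤2[δ/2]+d+s : ∀ {δ d s} → δ < d → d * δ ≤ d + d + s → δ * δ ≤ 2 * (δ / 2) + (d + s)
δ*δ≤2[δ/2]+d+s {zero}        _        _ = z≤n
δ*δ≤2[δ/2]+d+s {suc zero}    {d} {s} 1<d _ = ≤-trans (<⇒≤ 1<d) (m≤m+n d s)
δ*δ≤2[δ/2]+d+s {suc (suc e)} {d} {s} 2+e<d walks = begin
  (2 + e) * (2 + e)            ≡⟨ difference-of-squares e ⟩
  (3 + e) * (1 + e) + 1        ≤⟨ +-monoˡ-≤ 1 (*-monoˡ-≤ (1 + e) 2+e<d) ⟩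
  d * (1 + e) + 1              ≡⟨ distrib d e ⟩
  d + d * e + 1                ≤⟨ +-monoˡ-≤ 1 (+-monoʳ-≤ d de≤s) ⟩
  d + s + 1                    ≤⟨ +-monoʳ-≤ (d + s) 1≤2h ⟩
  d + s + 2 * ((2 + e) / 2)    ≡⟨ +-comm (d + s) _ ⟩
  2 * ((2 + e) / 2) + (d + s)  ∎
  where
  open ≤-Reasoning
  difference-of-squares : ∀ e → (2 + e) * (2 + e) ≡ (3 + e) * (1 + e) + 1
  difference-of-squares = solve-∀
  distrib : ∀ d e → d * (1 + e) + 1 ≡ d + d * e + 1
  distrib = solve-∀
  distrib₂ : ∀ d e → d + d + d * e ≡ d * (2 + e)
  distrib₂ = solve-∀
  de≤s : d * e ≤ s
  de≤s = +-cancelˡ-≤ (d + d) _ _ (≤-trans (≤-reflexive (distrib₂ d e)) walks)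
  1≤2h : 1 ≤ 2 * ((2 + e) / 2)
  1≤2h = ≤-trans (m≥n⇒m/n>0 {2 + e} {2} (m≤m+n 2 e)) (m≤n*m _ 2)

-- Read d as deg v, and M and s as the numbers of 2-walks from v ending in N(v) and outside N[v].
-- Either M/2 ≤ ⌊δ/2⌋, or M > δ and then d ≥ M exceeds δ enough to pay for it.
ball₂-arith : ∀ {δ d M s} → δ ≤ d → M ≤ d → 2 ∣ M → d * δ ≤ d + M + s →
              δ * δ ∸ 2 * (δ / 2) ≤ d + s
ball₂-arith {δ} {d} {_} {s} δ≤d M≤d (divides K refl) walks =
  m≤n+o⇒m∸n≤o (δ * δ) (2 * (δ / 2)) square
  where
  h : ℕ
  h = δ / 2
  square : δ * δ ≤ 2 * h + (d + s)
  square with K ≤? h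
  ... | yes K≤h = begin
    δ * δ          ≤⟨ *-monoˡ-≤ δ δ≤d ⟩
    d * δ          ≤⟨ walks ⟩
    d + K * 2 + s  ≤⟨ +-monoˡ-≤ s (+-monoʳ-≤ d (*-monoˡ-≤ 2 K≤h)) ⟩
    d + h * 2 + s  ≡⟨ rearrange d h s ⟩
    2 * h + (d + s) ∎
    where
    open ≤-Reasoning
    rearrange : ∀ d h s → d + h * 2 + s ≡ 2 * h + (d + s)
    rearrange = solve-∀
  ... | no K≰h = δ*δ≤2[δ/2]+d+s δ<d (≤-trans walks (+-monoˡ-≤ s (+-monoʳ-≤ d M≤d)))
    where
    δ<d : δ < d
    δ<d = ≤-trans (s≤s (δ≤1+[δ/2]*2 δ)) (≤-trans (*-monoˡ-≤ 2 (≰⇒> K≰h)) M≤d)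

data Ascending {q : ℕ} (b : Fin q → Bool) : ℕ → ℕ → Set where
  []   : ∀ {lo} → Ascending b 0 lo
  cons : ∀ {m lo} (i : Fin q) → T (b i) → lo ≤ toℕ i → Ascending b m (suc (toℕ i)) →
         Ascending b (suc m) lo

ascending-suc : ∀ {q} {b : Fin (suc q) → Bool} {m lo lo′} →
                lo′ ≤ suc lo → Ascending (b ∘ Fin.suc) m lo → Ascending b m lo′
ascending-suc _     []                    = []
ascending-suc lo′≤ (cons i bi lo≤i rest) =
  cons (Fin.suc i) bi (≤-trans lo′≤ (s≤s lo≤i)) (ascending-suc ≤-refl rest)

ascending : ∀ {q} (b : Fin q → Bool) {m} → m ≤ count b → Ascending b m 0
ascending {zero}  b {zero}  _ = []
ascending {zero}  b {suc m} ()
ascending {suc q} b {m} m≤ with b Fin.zero in b0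
ascending {suc q} b {zero}  _        | true  = []
ascending {suc q} b {suc m} (s≤s m≤) | true  =
  cons Fin.zero (subst T (sym b0) tt) z≤n (ascending-suc ≤-refl (ascending (b ∘ Fin.suc) m≤))
ascending {suc q} b {m}     m≤       | false = ascending-suc z≤n (ascending (b ∘ Fin.suc) m≤)

ascending-room : ∀ {q} {b : Fin q → Bool} {m lo} → Ascending b m lo → lo ≤ q → m + lo ≤ q
ascending-room []                            lo≤q = lo≤q
ascending-room {q} {m = suc m} {lo} (cons i _ lo≤i rest) _ = begin
  suc m + lo       ≡⟨ +-suc m lo ⟨
  m + suc lo       ≤⟨ +-monoʳ-≤ m (s≤s lo≤i) ⟩
  m + suc (toℕ i)  ≤⟨ ascending-room rest (Finₚ.toℕ<n i) ⟩
  q                ∎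
  where open ≤-Reasoning

1≤count⇒∃ : ∀ {q} (b : Fin q → Bool) → 1 ≤ count b → ∃[ i ] T (b i)
1≤count⇒∃ b 1≤ with ascending b 1≤
... | cons i bi _ _ = i , bi

2≤count⇒∃≢ : ∀ {q} (b : Fin q → Bool) → 2 ≤ count b →
             ∃₂ λ i j → i ≢ j × T (b i) × T (b j)
2≤count⇒∃≢ b 2≤ with ascending b 2≤
... | cons i bi _ (cons j bj i<j _) = i , j , (λ i≡j → <-irrefl (cong toℕ i≡j) i<j) , bi , bj

-- For x ≤ y: on a cycle of length q, y is at most r steps from x forwards or backwards.
ArcClose : ℕ → ℕ → ℕ → ℕ → Set
ArcClose q r x y = y ≤ x + r ⊎ x + q ≤ y + r

arc-close : ∀ {q r x y} → x ≤ y → ∣ x - y ∣ ⊓ (q ∸ ∣ x - y ∣) ≤ r → ArcClose q r x y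
arc-close {q} {r} {x} {y} x≤y arc≤r rewrite m≤n⇒∣m-n∣≡n∸m x≤y
  with ⊓-sel (y ∸ x) (q ∸ (y ∸ x))
... | inj₁ eq = inj₁ (begin
  y            ≡⟨ m+[n∸m]≡n x≤y ⟨
  x + (y ∸ x)  ≤⟨ +-monoʳ-≤ x (subst (_≤ r) eq arc≤r) ⟩
  x + r        ∎)
  where open ≤-Reasoning
... | inj₂ eq = inj₂ (begin
  x + q                        ≤⟨ +-monoʳ-≤ x (m≤n+m∸n q (y ∸ x)) ⟩
  x + (y ∸ x + (q ∸ (y ∸ x)))  ≤⟨ +-monoʳ-≤ x (+-monoʳ-≤ (y ∸ x) (subst (_≤ r) eq arc≤r)) ⟩
  x + (y ∸ x + r)              ≡⟨ +-assoc x (y ∸ x) r ⟨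
  x + (y ∸ x) + r              ≡⟨ cong (_+ r) (m+[n∸m]≡n x≤y) ⟩
  y + r                        ∎)
  where open ≤-Reasoning

module _ {q r : ℕ} {b : Fin q → Bool} (3r<q : 3 * r < q)
         (close : ∀ {i j} → T (b i) → T (b j) → toℕ i < toℕ j → ArcClose q r (toℕ i) (toℕ j))
         where

  -- Scan the run from its first position x.  Invariant: the current position p lies within
  -- x + r, yet p plus the number of positions still to come exceeds x + r.  A step p → y that
  -- wraps around the cycle leaves too little room below q for the positions after y; a step that
  -- does not wrap has y − x ≤ 2r < q − r, so y stays within x + r.
  no-close-run : ¬ Ascending b (2 + r) 0
  no-close-run (cons x bx _ rest) = scan bx ≤-refl (m≤m+n (toℕ x) r) ≤-refl rest
    where
    open ≤-Reasoning
    scan : ∀ {m} {p : Fin q} → T (b p) → toℕ x ≤ toℕ p → toℕ p ≤ toℕ x + r →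
           toℕ x + suc r ≤ toℕ p + m → Ascending b m (suc (toℕ p)) → ⊥
    scan {p = p} _ _ p≤x+r beyond [] =
      n≮n r (+-cancelˡ-≤ (toℕ x) _ _ (begin
        toℕ x + suc r ≤⟨ beyond ⟩
        toℕ p + 0     ≡⟨ +-identityʳ (toℕ p) ⟩
        toℕ p         ≤⟨ p≤x+r ⟩
        toℕ x + r     ∎))
    scan {m = suc m} {p} bp x≤p p≤x+r beyond (cons y by p<y rest) with close bp by p<y
    ... | inj₂ wrap = n≮n (r + toℕ y) (begin-strict
      r + toℕ y                    <⟨ +-monoˡ-≤ (toℕ y) (m≤n+m (suc r) (toℕ x)) ⟩
      toℕ x + suc r + toℕ y        ≤⟨ +-monoˡ-≤ (toℕ y) beyond ⟩
      toℕ p + suc m + toℕ y        ≡⟨ rearrange (toℕ p) m (toℕ y) ⟩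
      toℕ p + (m + suc (toℕ y))    ≤⟨ +-monoʳ-≤ (toℕ p) (ascending-room rest (Finₚ.toℕ<n y)) ⟩
      toℕ p + q                    ≤⟨ wrap ⟩
      toℕ y + r                    ≡⟨ +-comm (toℕ y) r ⟩
      r + toℕ y                    ∎)
      where
      rearrange : ∀ a k c → a + suc k + c ≡ a + (k + suc c)
      rearrange = solve-∀
    ... | inj₁ y≤p+r with close bx by (≤-<-trans x≤p p<y)
    ...   | inj₂ wrap = <⇒≱ 3r<q (+-cancelˡ-≤ (toℕ x) _ _ (begin
      toℕ x + q          ≤⟨ wrap ⟩
      toℕ y + r          ≤⟨ +-monoˡ-≤ r y≤p+r ⟩
      toℕ p + r + r      ≤⟨ +-monoˡ-≤ r (+-monoˡ-≤ r p≤x+r) ⟩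
      toℕ x + r + r + r  ≡⟨ three (toℕ x) r ⟩
      toℕ x + 3 * r      ∎))
      where
      three : ∀ a k → a + k + k + k ≡ a + 3 * k
      three = solve-∀
    ...   | inj₁ y≤x+r = scan by (≤-trans x≤p (<⇒≤ p<y)) y≤x+r (begin
      toℕ x + suc r    ≤⟨ beyond ⟩
      toℕ p + suc m    ≡⟨ +-suc (toℕ p) m ⟩
      suc (toℕ p) + m  ≤⟨ +-monoˡ-≤ m p<y ⟩
      toℕ y + m        ∎) rest

pairwise-close⇒count≤1+r : ∀ {q} r (b : Fin q → Bool) → 3 * r < q →
  (∀ i j → T (b i) → T (b j) → ∣ toℕ i - toℕ j ∣ ⊓ (q ∸ ∣ toℕ i - toℕ j ∣) ≤ r) →
  count b ≤ suc r
pairwise-close⇒count≤1+r {q} r b 3r<q arc≤r with 2 + r ≤? count b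
... | no  2+r≰ = ≤-pred (≰⇒> 2+r≰)
... | yes 2+r≤ = ⊥-elim (no-close-run 3r<q close (ascending b 2+r≤))
  where
  close : ∀ {i j} → T (b i) → T (b j) → toℕ i < toℕ j → ArcClose q r (toℕ i) (toℕ j)
  close {i} {j} bi bj i<j = arc-close (<⇒≤ i<j) (arc≤r i j bi bj)

module _ {n : ℕ} (G : Graph n) where
  open Graph G using (adj; irrefl) renaming (sym to adj-sym)

  edge-sym : ∀ {x y} → Edge G x y → Edge G y x
  edge-sym {x} {y} = subst T (adj-sym x y)

  edge⇒≢ : ∀ {x y} → Edge G x y → x ≢ y
  edge⇒≢ {x} e refl = subst T (irrefl x) e

  _++ʷ_ : ∀ {x y z k l} → Walk G x y k → Walk G y z l → Walk G x z (k + l)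
  here _   ++ʷ w = w
  step e p ++ʷ w = step e (p ++ʷ w)

  reverse : ∀ {x y ℓ} → Walk G x y ℓ → Walk G y x ℓ
  reverse (here x) = here x
  reverse {x} (step {ℓ = ℓ} e p) =
    subst (Walk G _ x) (+-comm ℓ 1) (reverse p ++ʷ step (edge-sym e) (here x))

  Dist⇒≤ : ∀ {x y d m} → Dist G x y d → Walk G x y m → d ≤ m
  Dist⇒≤ (_ , shortest) w = ≮⇒≥ (λ m<d → shortest _ m<d w)

  A : Fin n → Fin n → ℕ
  A x y = 𝟙 (adj x y)

  degree≡count : ∀ v → degree G v ≡ count (adj v)
  degree≡count v = trans (cong ListAction.sum (map-tabulate id (A v))) (sum-tabulate {n} (A v))

  common : Fin n → Fin n → ℕ
  common x y = count (λ u → adj x u ∧ adj u y)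

  common≡∑ : ∀ x y → common x y ≡ ∑[ u < n ] (A x u * A u y)
  common≡∑ x y = sum-cong-≗ {n} (λ u → 𝟙-∧ (adj x u) (adj u y))

  common-self : ∀ v → common v v ≡ degree G v
  common-self v = trans (sum-cong-≗ {n} (λ u → cong 𝟙 (adj-∧-adj u))) (sym (degree≡count v))
    where
    adj-∧-adj : ∀ u → (adj v u ∧ adj u v) ≡ adj v u
    adj-∧-adj u = trans (cong (adj v u ∧_) (adj-sym u v)) (∧-idem (adj v u))

  N[_] : Fin n → Fin n → Bool
  N[ v ] w = v == w ∨ adj v w

  ball₂ : Fin n → Fin n → Bool
  ball₂ v w = N[ v ] w ∨ (0 <ᵇ common v w)

  ball₂⇒walk : ∀ {v w} → T (ball₂ v w) → ∃[ m ] m ≤ 2 × Walk G v w m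
  ball₂⇒walk {v} {w} inB with v Finₚ.≟ w | adj v w in vw
  ... | yes refl | _     = 0 , z≤n , here v
  ... | no _     | true  = 1 , s≤s z≤n , step (subst T (sym vw) tt) (here w)
  ... | no _     | false with 1≤count⇒∃ {n} _ (<ᵇ⇒< 0 (common v w) inB)
  ...   | u , vuw with Equivalence.to T-∧ vuw
  ...     | vu , uw = 2 , ≤-refl , step vu (step uw (here w))

  ball₂-overlap⇒dist≤4 : ∀ {x y w d} → Dist G x y d → T (ball₂ x w) → T (ball₂ y w) → d ≤ 4
  ball₂-overlap⇒dist≤4 dist xw yw with ball₂⇒walk xw | ball₂⇒walk yw
  ... | k , k≤2 , p | l , l≤2 , p′ =
    ≤-trans (Dist⇒≤ dist (p ++ʷ reverse p′)) (+-mono-≤ k≤2 l≤2)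

  walks₂-within walks₂-beyond : Fin n → ℕ
  walks₂-within v = ∑[ w < n ] (A v w * common v w)
  walks₂-beyond v = ∑[ w < n ] (𝟙 (not (N[ v ] w)) * common v w)

  𝟙-trichotomy : ∀ v w → 𝟙 (v == w) + A v w + 𝟙 (not (N[ v ] w)) ≡ 1
  𝟙-trichotomy v w with v Finₚ.≟ w
  ... | yes refl rewrite irrefl v = refl
  ... | no _ with adj v w
  ...   | true  = refl
  ...   | false = refl

  ∑-common≡∑-degree : ∀ v → ∑[ w < n ] common v w ≡ ∑[ u < n ] (A v u * degree G u)
  ∑-common≡∑-degree v = begin
    ∑[ w < n ] common v w                 ≡⟨ sum-cong-≗ {n} (common≡∑ v) ⟩
    ∑[ w < n ] ∑[ u < n ] (A v u * A u w) ≡⟨ ∑-comm {n} {n} _ ⟩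
    ∑[ u < n ] ∑[ w < n ] (A v u * A u w) ≡⟨ sum-cong-≗ {n} (λ u → *-distribˡ-sum {n} (A v u) _) ⟨
    ∑[ u < n ] (A v u * count (adj u))    ≡⟨ sum-cong-≗ {n} (λ u → cong (A v u *_) (degree≡count u)) ⟨
    ∑[ u < n ] (A v u * degree G u)       ∎
    where open ≡-Reasoning

  ∑-common≡degree+within+beyond : ∀ v →
    ∑[ w < n ] common v w ≡ degree G v + walks₂-within v + walks₂-beyond v
  ∑-common≡degree+within+beyond v =
    trans (∑-split₃ (𝟙 ∘ (v ==_)) (A v) (𝟙 ∘ not ∘ N[ v ]) (common v) (𝟙-trichotomy v))
          (cong (λ c → c + walks₂-within v + walks₂-beyond v)
                (trans (∑-pick v (common v)) (common-self v)))

  degree*δ≤∑-common : ∀ {δ} → (∀ u → δ ≤ degree G u) → ∀ v →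
                      degree G v * δ ≤ ∑[ w < n ] common v w
  degree*δ≤∑-common {δ} δ≤degree v = begin
    degree G v * δ                   ≡⟨ cong (_* δ) (degree≡count v) ⟩
    count (adj v) * δ                ≡⟨ *-distribʳ-sum {n} δ _ ⟩
    ∑[ u < n ] (A v u * δ)           ≤⟨ ∑-mono-≤ (λ u → *-monoʳ-≤ (A v u) (δ≤degree u)) ⟩
    ∑[ u < n ] (A v u * degree G u)  ≡⟨ ∑-common≡∑-degree v ⟨
    ∑[ w < n ] common v w            ∎
    where open ≤-Reasoning

  walks₂-within-even : ∀ v → 2 ∣ walks₂-within v
  walks₂-within-even v = subst (2 ∣_) (sym expand) (∑∑-symmetric-even h h-sym h-diag)
    where
    h : Fin n → Fin n → ℕ
    h w u = A v w * (A v u * A u w)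
    expand : walks₂-within v ≡ ∑[ w < n ] ∑[ u < n ] h w u
    expand = sum-cong-≗ {n} (λ w →
      trans (cong (A v w *_) (common≡∑ v w)) (*-distribˡ-sum {n} (A v w) _))
    swap : ∀ a b c → a * (b * c) ≡ b * (a * c)
    swap = solve-∀
    h-sym : ∀ w u → h w u ≡ h u w
    h-sym w u = trans (swap (A v w) (A v u) (A u w))
                      (cong (λ k → A v u * (A v w * 𝟙 k)) (adj-sym u w))
    h-diag : ∀ u → h u u ≡ 0
    h-diag u rewrite irrefl u = trans (cong (A v u *_) (*-zeroʳ (A v u))) (*-zeroʳ (A v u))

  module _ (c4 : C4Free G) where

    common≤1 : ∀ {x y} → x ≢ y → common x y ≤ 1
    common≤1 {x} {y} x≢y = ≮⇒≥ (λ 2≤common → four-cycle (2≤count⇒∃≢ _ 2≤common))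
      where
      four-cycle : ∃₂ (λ u u′ → u ≢ u′ × T (adj x u ∧ adj u y) × T (adj x u′ ∧ adj u′ y)) → ⊥
      four-cycle (u , u′ , u≢u′ , xuy , xu′y) with Equivalence.to T-∧ xuy | Equivalence.to T-∧ xu′y
      ... | xu , uy | xu′ , u′y =
        c4 x u y u′ (edge⇒≢ xu) x≢y (edge⇒≢ xu′) (edge⇒≢ uy) u≢u′ (edge⇒≢ (edge-sym u′y))
           (xu , uy , edge-sym u′y , edge-sym xu′)

    walks₂-within≤degree : ∀ v → walks₂-within v ≤ degree G v
    walks₂-within≤degree v = ≤-trans (∑-mono-≤ bound) (≤-reflexive (sym (degree≡count v)))
      where
      bound : ∀ w → A v w * common v w ≤ A v w
      bound w with adj v w in vw
      ... | false = z≤n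
      ... | true  = ≤-trans (≤-reflexive (+-identityʳ _)) (common≤1 (edge⇒≢ (subst T (sym vw) tt)))

    𝟙-ball₂ : ∀ v w → 𝟙 (v == w) + A v w + 𝟙 (not (N[ v ] w)) * common v w ≤ 𝟙 (ball₂ v w)
    𝟙-ball₂ v w with v Finₚ.≟ w
    ... | yes refl rewrite irrefl v = ≤-refl
    ... | no v≢w with adj v w
    ...   | true  = ≤-refl
    ...   | false = at-most-one (common v w) (common≤1 v≢w)
      where
      at-most-one : ∀ c → c ≤ 1 → 1 * c ≤ 𝟙 (0 <ᵇ c)
      at-most-one zero          _         = z≤n
      at-most-one (suc zero)    _         = ≤-refl
      at-most-one (suc (suc c)) (s≤s ())

    1+degree+beyond≤ball₂ : ∀ v → 1 + degree G v + walks₂-beyond v ≤ count (ball₂ v)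
    1+degree+beyond≤ball₂ v = begin
      1 + degree G v + walks₂-beyond v
        ≡⟨ cong₂ (λ a b → a + b + walks₂-beyond v) (sym (count-≟ v)) (degree≡count v) ⟩
      count (v ==_) + count (adj v) + walks₂-beyond v
        ≡⟨ ∑-distrib-+₃ {n} _ _ _ ⟨
      ∑[ w < n ] (𝟙 (v == w) + A v w + 𝟙 (not (N[ v ] w)) * common v w)
        ≤⟨ ∑-mono-≤ (𝟙-ball₂ v) ⟩
      count (ball₂ v) ∎
      where open ≤-Reasoning

    ball₂-size : ∀ {δ} → (∀ u → δ ≤ degree G u) → ∀ v →
                 δ * δ ∸ 2 * (δ / 2) + 1 ≤ count (ball₂ v)
    ball₂-size {δ} δ≤degree v = begin
      δ * δ ∸ 2 * (δ / 2) + 1    ≤⟨ +-monoˡ-≤ 1 arith ⟩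
      d + walks₂-beyond v + 1    ≡⟨ +-comm (d + walks₂-beyond v) 1 ⟩
      1 + (d + walks₂-beyond v)  ≡⟨ +-assoc 1 d _ ⟨
      1 + d + walks₂-beyond v    ≤⟨ 1+degree+beyond≤ball₂ v ⟩
      count (ball₂ v)            ∎
      where
      open ≤-Reasoning
      d : ℕ
      d = degree G v
      walks : d * δ ≤ d + walks₂-within v + walks₂-beyond v
      walks = ≤-trans (degree*δ≤∑-common δ≤degree v)
                      (≤-reflexive (∑-common≡degree+within+beyond v))
      arith : δ * δ ∸ 2 * (δ / 2) ≤ d + walks₂-beyond v
      arith = ball₂-arith (δ≤degree v) (walks₂-within≤degree v) (walks₂-within-even v) walks

proposition9 : (n : ℕ) (G : Graph n) (δ q : ℕ) →
    C4Free G → MinDegree G δ → Equator G q → 15 < q →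
    q * (δ * δ ∸ 2 * (δ / 2) + 1) ≤ 5 * n
proposition9 n G δ q c4 (δ≤degree , _) ((C , isometric) , _) 15<q = begin
  q * (δ * δ ∸ 2 * (δ / 2) + 1)  ≤⟨ double-count (λ i w → 𝟙 (ball₂ G (vertex i) w))
                                      (λ i → ball₂-size G c4 δ≤degree (vertex i)) at-most-five ⟩
  n * 5                          ≡⟨ *-comm n 5 ⟩
  5 * n                          ∎
  where
  open ≤-Reasoning
  open Cycle C
  at-most-five : ∀ w → count (λ i → ball₂ G (vertex i) w) ≤ 5
  at-most-five w = pairwise-close⇒count≤1+r 4 _ (m+n≤o⇒n≤o 3 15<q)
    (λ i j iw jw → ball₂-overlap⇒dist≤4 G (isometric i j) iw jw)
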